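{- Let $\Pi = (\mathcal{A}, \mathcal{R})$ be a ground epistemic logic program and let $\Pi' = (\mathcal{A}', \mathcal{R})$ be the ELP with the same set of rules but with a set of atoms $\mathcal{A}' \supsetneq \mathcal{A}$. Then the set of candidate world views of $\Pi'$ is $\{ W \cup \{ \neg a \mid a \in \mathcal{A}'\setminus\mathcal{A} \} \mid W \text{ a candidate world view of } \Pi \}$.
   Context: A literal over a set of atoms $\mathcal{A}$ is an atom $a\in\mathcal{A}$ or its default negation $\neg a$. A logic program (with double negation) is a pair $(\mathcal{A},\mathcal{R})$ with rules $a_1\vee\dots\vee a_l \leftarrow a_{l+1},\dots,a_m,\neg\ell_1,\dots,\neg\ell_n$ ($a_i\in\mathcal{A}$, $\ell_i$ literals). An interpretation $I\subseteq\mathcal{A}$ satisfies $a$ iff $a\in I$, satisfies $\neg \ell$ iff it does not satisfy $\ell$; it is a model of a rule if whenever it satisfies all body elements it contains some head atom. The GL-reduct $\Pi^I$ keeps, for each rule all of whose negated body elements are satisfied by $I$, the rule $\mathrm{head}\leftarrow$ (positive body atoms). $M\subseteq\mathcal{A}$ is an answer set of $\Pi$ if $M$ is a model of $\Pi$ and no $M'\subsetneq M$ is a model of $\Pi^M$; $\mathrm{AS}(\Pi)$ is the set of answer sets. An epistemic literal is $\mathbf{not}\,\ell$ for a literal $\ell$. A ground ELP is $\Pi=(\mathcal{A},\mathcal{R})$ with rules $a_1\vee\dots\vee a_k \leftarrow \ell_1,\dots,\ell_m,\xi_1,\dots,\xi_j,\neg\xi_{j+1},\dots,\neg\xi_n$,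 with $a_i\in\mathcal{A}$, $\ell_i$ literals, $\xi_i$ epistemic literals over $\mathcal{A}$. A candidate world interpretation (CWI) is a consistent set $I$ of literals over the program's atom set $\mathcal{A}$; write $I^P=\{a: a\in I\}$, $I^N=\{a:\neg a\in I\}$, $I^U=\mathcal{A}\setminus(I^P\cup I^N)$. The epistemic reduct $\Pi^I$ replaces each epistemic literal $\mathbf{not}\,\ell$ by $\neg\ell$ if $\ell\in I$ and by $\top$ otherwise. A CWI $I$ is compatible with a set $\mathcal{I}$ of interpretations if $\mathcal{I}\neq\emptyset$, every $a\in I^P$ is in every $J\in\mathcal{I}$, no $a\in I^N$ is in any $J\in\mathcal{I}$, and each $a\in I^U$ is in some $J\in\mathcal{I}$ and not in some $J'\in\mathcal{I}$. $I$ is a candidate world view (CWV) of $\Pi$ iff $\mathrm{AS}(\Pi^I)$ is compatible with $I$. -}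

module Defs where

open import Data.List using (List; []; _∷_; _++_; map; concatMap)
open import Data.List.Membership.Propositional using (_∈_; _∉_)
open import Data.List.Relation.Unary.All using (All)
open import Data.List.Relation.Unary.Any using (Any)
open import Data.Product using (Σ; ∃; ∃-syntax; _×_; _,_)
open import Data.Sum using (_⊎_)
open import Data.Unit using (⊤)
open import Data.Empty using (⊥)
open import Relation.Nullary using (¬_; yes; no)
open import Relation.Binary.PropositionalEquality using (_≡_; refl; cong)
open import Relation.Binary.Definitions using (DecidableEquality)
open import Function.Bundles using (_⇔_)
import Data.List.Membership.DecPropositional as DecMem

-- Atoms are drawn from an arbitrary type `Atom` with decidable equality;
-- finite sets of atoms are lists (read as sets, i.e. up to membership).

module _ {Atom : Set} where

  data Lit : Set where
    pos : Atom → Lit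
    neg : Atom → Lit

  atomOf : Lit → Atom
  atomOf (pos a) = a
  atomOf (neg a) = a

  _⊆_ : List Atom → List Atom → Set
  X ⊆ Y = ∀ {a} → a ∈ X → a ∈ Y

  _⊊_ : List Atom → List Atom → Set
  X ⊊ Y = X ⊆ Y × ∃[ a ] (a ∈ Y × a ∉ X)

  data Form : Set where
    fatom : Atom → Form
    fneg  : Form → Form
    ftop  : Form

  _⊨_ : List Atom → Form → Set
  I ⊨ fatom a = a ∈ I
  I ⊨ fneg φ  = ¬ (I ⊨ φ)
  I ⊨ ftop    = ⊤

  -- rule  head ← pbody, ¬φ₁, …, ¬φₙ   (negs = [φ₁,…,φₙ])
  record LRule : Set where
    constructor lrule
    field
      head  : List Atom
      pbody : List Atom
      negs  : List Form
  open LRule public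

  record LP : Set where
    constructor lp
    field
      lpAtoms : List Atom
      lpRules : List LRule
  open LP public

  NegSat : List Atom → LRule → Set
  NegSat I r = All (λ φ → ¬ (I ⊨ φ)) (negs r)

  ModelRule : List Atom → LRule → Set
  ModelRule I r = All (_∈ I) (pbody r) → NegSat I r → Any (_∈ I) (head r)

  ModelLP : List Atom → LP → Set
  ModelLP I P = All (ModelRule I) (lpRules P)

  -- GL-reduct  P^I : for every rule whose negated body elements are all
  -- satisfied by I, the positive rule  head ← pbody.
  -- M' is a model of P^I  (written out as the reduct literally unfolds):
  ModelReduct : LP → List Atom → List Atom → Set
  ModelReduct P I M' =
    All (λ r → NegSat I r → All (_∈ M') (pbody r) → Any (_∈ M') (head r))
        (lpRules P)

  AnswerSet : LP → List Atom → Set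
  AnswerSet P M =
    M ⊆ lpAtoms P × ModelLP M P × (∀ M' → M' ⊊ M → ¬ ModelReduct P M M')

  -- Ground epistemic logic programs.
  -- rule  head ← body(literals), not ℓ (ℓ ∈ epos), ¬ not ℓ (ℓ ∈ eneg)

  record ERule : Set where
    constructor erule
    field
      ehead : List Atom
      ebody : List Lit
      epos  : List Lit
      eneg  : List Lit
  open ERule public

  record ELP : Set where
    constructor elp
    field
      atoms : List Atom
      rules : List ERule
  open ELP public

  WellFormed : ELP → Set
  WellFormed Π =
    All (λ r → All (_∈ atoms Π) (ehead r)
             × All (λ ℓ → atomOf ℓ ∈ atoms Π) (ebody r)
             × All (λ ℓ → atomOf ℓ ∈ atoms Π) (epos r)
             × All (λ ℓ → atomOf ℓ ∈ atoms Π) (eneg r))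
        (rules Π)

  litForm : Lit → Form
  litForm (pos a) = fatom a
  litForm (neg a) = fneg (fatom a)

  posAtoms : List Lit → List Atom
  posAtoms [] = []
  posAtoms (pos a ∷ ls) = a ∷ posAtoms ls
  posAtoms (neg a ∷ ls) = posAtoms ls

  negForms : List Lit → List Form
  negForms [] = []
  negForms (pos a ∷ ls) = negForms ls
  negForms (neg a ∷ ls) = fatom a ∷ negForms ls

  CWI : List Atom → List Lit → Set
  CWI 𝒜 I = All (λ ℓ → atomOf ℓ ∈ 𝒜) I × (∀ a → pos a ∈ I → neg a ∈ I → ⊥)

  Compatible : List Atom → List Lit → (List Atom → Set) → Set
  Compatible 𝒜 I 𝓘 =
      (∃[ J ] 𝓘 J)
    × (∀ a → pos a ∈ I → ∀ J → 𝓘 J → a ∈ J)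
    × (∀ a → neg a ∈ I → ∀ J → 𝓘 J → a ∉ J)
    × (∀ a → a ∈ 𝒜 → pos a ∉ I → neg a ∉ I →
          (∃[ J ] (𝓘 J × a ∈ J)) × (∃[ J ] (𝓘 J × a ∉ J)))

  _≐_ : List Lit → List Lit → Set
  I ≐ K = ∀ ℓ → (ℓ ∈ I) ⇔ (ℓ ∈ K)

module _ {Atom : Set} (_≟_ : DecidableEquality Atom) where

  _≟L_ : DecidableEquality (Lit {Atom})
  pos a ≟L pos b with a ≟ b
  ... | yes refl = yes refl
  ... | no a≢b = no λ { refl → a≢b refl }
  pos a ≟L neg b = no λ ()
  neg a ≟L pos b = no λ ()
  neg a ≟L neg b with a ≟ b
  ... | yes refl = yes refl
  ... | no a≢b = no λ { refl → a≢b refl }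

  open DecMem _≟L_ using (_∈?_)

  -- epistemic literal  not ℓ  ↦  ¬ℓ if ℓ ∈ I, ⊤ otherwise (⊤ dropped)
  eposForms : List Lit → List Lit → List Form
  eposForms I [] = []
  eposForms I (ℓ ∷ ls) with ℓ ∈? I
  ... | yes _ = litForm ℓ ∷ eposForms I ls
  ... | no  _ = eposForms I ls

  -- ¬ not ℓ  ↦  ¬¬ℓ if ℓ ∈ I, ¬⊤ otherwise
  enegForms : List Lit → List Lit → List Form
  enegForms I [] = []
  enegForms I (ℓ ∷ ls) with ℓ ∈? I
  ... | yes _ = fneg (litForm ℓ) ∷ enegForms I ls
  ... | no  _ = ftop ∷ enegForms I ls

  reduceRule : List Lit → ERule → LRule
  reduceRule I r = lrule (ehead r) (posAtoms (ebody r))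
    (negForms (ebody r) ++ eposForms I (epos r) ++ enegForms I (eneg r))

  EReduct : ELP → List Lit → LP
  EReduct Π I = lp (atoms Π) (map (reduceRule I) (rules Π))

  CWV : ELP → List Lit → Set
  CWV Π I = CWI (atoms Π) I × Compatible (atoms Π) I (AnswerSet (EReduct Π I))

-- Atoms of 𝒜′ ∖ 𝒜 occur in no rule, so (i) they occur in no answer set of any
-- reduct, since removing them from an answer set leaves a model of the GL-reduct,
-- and (ii) the epistemic reduct Π^I depends only on the literals of I over 𝒜.
-- By (i) a candidate world view of Π′ must contain ¬a for each such atom a and
-- can contain no a; by (ii) its part over 𝒜 then has the same answer sets and
-- is a candidate world view of Π, and conversely.
module Submission where

open import Defs
open import Data.List using (List; []; _∷_; _++_; map; filter)
open import Data.List.Membership.Propositional using (_∈_; _∉_)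
open import Data.List.Membership.Propositional.Properties using (∈-filter⁺; ∈-filter⁻)
open import Data.List.Relation.Unary.All as All using (All; []; _∷_)
open import Data.List.Relation.Unary.All.Properties using (map⁺)
open import Data.List.Relation.Unary.Any using (Any; here; there)
open import Data.Product using (∃-syntax; _×_; _,_; proj₁; proj₂)
open import Data.Product.Function.NonDependent.Propositional using (_×-⇔_)
open import Data.Sum using (_⊎_; inj₁; inj₂)
open import Data.Empty using (⊥; ⊥-elim)
open import Relation.Nullary using (yes; no)
open import Relation.Binary.PropositionalEquality using (_≡_; refl; cong; cong₂; subst)
open import Relation.Binary.Definitions using (DecidableEquality)
open import Function.Base using (_∘′_)
open import Function.Bundles using (_⇔_; mk⇔; Equivalence)
open import Function.Construct.Composition using (_⇔-∘_)
open import Function.Construct.Symmetry using (⇔-sym)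
import Data.List.Membership.DecPropositional as DecMem

open Equivalence using (to; from)

module _ {Atom : Set} where

  HeadsWithin : List Atom → List LRule → Set
  HeadsWithin 𝒜 R = All (λ r → All (_∈ 𝒜) (head r)) R

  LitsOver : List Atom → List Lit → Set
  LitsOver 𝒜 = All (λ ℓ → atomOf ℓ ∈ 𝒜)

  _≐_over_ : List Lit → List Lit → List Atom → Set
  I ≐ W over 𝒜 = ∀ ℓ → atomOf ℓ ∈ 𝒜 → (ℓ ∈ I) ⇔ (ℓ ∈ W)

  NegOutside : List Atom → List Atom → Lit → Set
  NegOutside 𝒜 𝒜′ ℓ = ∃[ a ] (ℓ ≡ neg a × a ∈ 𝒜′ × a ∉ 𝒜)

  Extends : List Atom → List Atom → List Lit → List Lit → Set
  Extends 𝒜 𝒜′ I W = ∀ ℓ → (ℓ ∈ I) ⇔ (ℓ ∈ W ⊎ NegOutside 𝒜 𝒜′ ℓ)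

  any-⊆-within : ∀ {𝒜 M M′ hs : List Atom} → (∀ {a} → a ∈ M → a ∈ 𝒜 → a ∈ M′) →
    All (_∈ 𝒜) hs → Any (_∈ M) hs → Any (_∈ M′) hs
  any-⊆-within M∩𝒜⊆M′ (h∈𝒜 ∷ _) (here h∈M) = here (M∩𝒜⊆M′ h∈M h∈𝒜)
  any-⊆-within M∩𝒜⊆M′ (_ ∷ hs∈𝒜) (there p) = there (any-⊆-within M∩𝒜⊆M′ hs∈𝒜 p)

  Compatible-cong : ∀ {𝒜 I} {𝓘 𝓙 : List Atom → Set} → (∀ J → 𝓘 J ⇔ 𝓙 J) →
    Compatible 𝒜 I 𝓘 ⇔ Compatible 𝒜 I 𝓙
  Compatible-cong {𝒜} {I} {𝓘} {𝓙} 𝓘⇔𝓙 = mk⇔ (transfer 𝓘⇔𝓙) (transfer (λ J → ⇔-sym (𝓘⇔𝓙 J)))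
    where
    transfer : ∀ {𝓚 𝓛 : List Atom → Set} → (∀ J → 𝓚 J ⇔ 𝓛 J) → Compatible 𝒜 I 𝓚 → Compatible 𝒜 I 𝓛
    transfer k⇔l ((J , kJ) , posI , negI , undI) =
      (J , to (k⇔l J) kJ) ,
      (λ a p J′ lJ′ → posI a p J′ (from (k⇔l J′) lJ′)) ,
      (λ a n J′ lJ′ → negI a n J′ (from (k⇔l J′) lJ′)) ,
      λ a a∈𝒜 np nn → let (J₁ , k₁ , a∈J₁) , (J₂ , k₂ , a∉J₂) = undI a a∈𝒜 np nn
                       in (J₁ , to (k⇔l J₁) k₁ , a∈J₁) , (J₂ , to (k⇔l J₂) k₂ , a∉J₂)

  pos-within : ∀ {𝒜 𝒜′ I} {𝓘 : List Atom → Set} → (∀ J → 𝓘 J → J ⊆ 𝒜) →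
    Compatible 𝒜′ I 𝓘 → ∀ {a} → pos a ∈ I → a ∈ 𝒜
  pos-within 𝓘⊆𝒜 ((J , 𝓘J) , posI , _) p = 𝓘⊆𝒜 J 𝓘J (posI _ p J 𝓘J)

  extends-⊇ : ∀ {𝒜 𝒜′ I W ℓ} → Extends 𝒜 𝒜′ I W → ℓ ∈ W → ℓ ∈ I
  extends-⊇ ext ℓ∈W = from (ext _) (inj₁ ℓ∈W)

  extends-pos : ∀ {𝒜 𝒜′ I W a} → Extends 𝒜 𝒜′ I W → pos a ∈ I → pos a ∈ W
  extends-pos {a = a} ext p with to (ext (pos a)) p
  ... | inj₁ p∈W = p∈W
  ... | inj₂ (_ , () , _)

  extends-agree : ∀ {𝒜 𝒜′ I W} → Extends 𝒜 𝒜′ I W → I ≐ W over 𝒜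
  extends-agree {I = I} {W} ext ℓ ℓ∈𝒜 = mk⇔ restrictI (extends-⊇ ext)
    where
    restrictI : ℓ ∈ I → ℓ ∈ W
    restrictI ℓ∈I with to (ext ℓ) ℓ∈I
    ... | inj₁ ℓ∈W = ℓ∈W
    ... | inj₂ (_ , refl , _ , a∉𝒜) = ⊥-elim (a∉𝒜 ℓ∈𝒜)

  CWI-extends : ∀ {𝒜 𝒜′ I W} → 𝒜 ⊆ 𝒜′ → LitsOver 𝒜 W → Extends 𝒜 𝒜′ I W →
    CWI 𝒜′ I ⇔ CWI 𝒜 W
  CWI-extends {𝒜} {𝒜′} {I} {W} 𝒜⊆𝒜′ W-over ext = mk⇔ restrict-cwi extend-cwi
    where
    restrict-cwi : CWI 𝒜′ I → CWI 𝒜 W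
    restrict-cwi (_ , consI) = W-over , λ a p n → consI a (extends-⊇ ext p) (extends-⊇ ext n)

    extend-cwi : CWI 𝒜 W → CWI 𝒜′ I
    extend-cwi (_ , consW) = All.tabulate (λ ℓ∈I → over (to (ext _) ℓ∈I)) , consI
      where
      over : ∀ {ℓ} → ℓ ∈ W ⊎ NegOutside 𝒜 𝒜′ ℓ → atomOf ℓ ∈ 𝒜′
      over (inj₁ ℓ∈W) = 𝒜⊆𝒜′ (All.lookup W-over ℓ∈W)
      over (inj₂ (_ , refl , a∈𝒜′ , _)) = a∈𝒜′

      consI : ∀ a → pos a ∈ I → neg a ∈ I → ⊥
      consI a p n with extends-pos ext p | to (ext (neg a)) n
      ... | p∈W | inj₁ n∈W = consW a p∈W n∈W
      ... | p∈W | inj₂ (_ , refl , _ , a∉𝒜) = a∉𝒜 (All.lookup W-over p∈W)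

module _ {Atom : Set} (_≟_ : DecidableEquality Atom) where
  open DecMem _≟_ using (_∈?_)
  open DecMem (_≟L_ _≟_) renaming (_∈?_ to _∈L?_) using ()

  infixl 30 _∩_ _↾_

  _∩_ : List Atom → List Atom → List Atom
  M ∩ 𝒜 = filter (_∈? 𝒜) M

  _↾_ : List Lit → List Atom → List Lit
  I ↾ 𝒜 = filter (λ ℓ → atomOf ℓ ∈? 𝒜) I

  ∩-⊆ : ∀ {M 𝒜} → M ∩ 𝒜 ⊆ M
  ∩-⊆ {M} a∈M∩𝒜 = proj₁ (∈-filter⁻ (_∈? _) {xs = M} a∈M∩𝒜)

  modelReduct-∩ : ∀ {𝒜 𝒜′ M} R → HeadsWithin 𝒜 R → ModelLP M (lp 𝒜′ R) →
    ModelReduct (lp 𝒜′ R) M (M ∩ 𝒜)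
  modelReduct-∩ [] [] [] = []
  modelReduct-∩ {𝒜′ = 𝒜′} (r ∷ R) (hs∈𝒜 ∷ H) (Mr ∷ MR) =
    (λ negSat body → any-⊆-within (∈-filter⁺ (_∈? _)) hs∈𝒜 (Mr (All.map ∩-⊆ body) negSat))
    ∷ modelReduct-∩ {𝒜′ = 𝒜′} R H MR

  answerSet⊆ : ∀ {𝒜 𝒜′ R M} → HeadsWithin 𝒜 R → AnswerSet (lp 𝒜′ R) M → M ⊆ 𝒜
  answerSet⊆ {𝒜} {𝒜′} {R} {M} H (_ , model , minimal) {a} a∈M with a ∈? 𝒜
  ... | yes a∈𝒜 = a∈𝒜
  ... | no a∉𝒜 = ⊥-elim (minimal (M ∩ 𝒜) (∩-⊆ , a , a∈M , a∉M∩𝒜) (modelReduct-∩ {𝒜′ = 𝒜′} R H model))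
    where
    a∉M∩𝒜 : a ∉ M ∩ 𝒜
    a∉M∩𝒜 q = a∉𝒜 (proj₂ (∈-filter⁻ (_∈? 𝒜) {xs = M} q))

  answerSet-resize : ∀ {𝒜 𝒜′ R M} → HeadsWithin 𝒜 R → 𝒜 ⊆ 𝒜′ →
    AnswerSet (lp 𝒜′ R) M ⇔ AnswerSet (lp 𝒜 R) M
  answerSet-resize H 𝒜⊆𝒜′ = mk⇔
    (λ as@(_ , model , minimal) → answerSet⊆ H as , model , minimal)
    (λ (M⊆𝒜 , model , minimal) → 𝒜⊆𝒜′ ∘′ M⊆𝒜 , model , minimal)

  eposForms-agree : ∀ {𝒜 I W} → I ≐ W over 𝒜 → ∀ ls → LitsOver 𝒜 ls →
    eposForms _≟_ I ls ≡ eposForms _≟_ W ls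
  eposForms-agree I≐W [] [] = refl
  eposForms-agree {I = I} {W} I≐W (ℓ ∷ ls) (ℓ∈𝒜 ∷ ls-over) with ℓ ∈L? I | ℓ ∈L? W
  ... | yes _   | yes _   = cong (litForm ℓ ∷_) (eposForms-agree I≐W ls ls-over)
  ... | no _    | no _    = eposForms-agree I≐W ls ls-over
  ... | yes ℓ∈I | no ℓ∉W = ⊥-elim (ℓ∉W (to (I≐W ℓ ℓ∈𝒜) ℓ∈I))
  ... | no ℓ∉I  | yes ℓ∈W = ⊥-elim (ℓ∉I (from (I≐W ℓ ℓ∈𝒜) ℓ∈W))

  enegForms-agree : ∀ {𝒜 I W} → I ≐ W over 𝒜 → ∀ ls → LitsOver 𝒜 ls →
    enegForms _≟_ I ls ≡ enegForms _≟_ W ls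
  enegForms-agree I≐W [] [] = refl
  enegForms-agree {I = I} {W} I≐W (ℓ ∷ ls) (ℓ∈𝒜 ∷ ls-over) with ℓ ∈L? I | ℓ ∈L? W
  ... | yes _   | yes _   = cong (fneg (litForm ℓ) ∷_) (enegForms-agree I≐W ls ls-over)
  ... | no _    | no _    = cong (ftop ∷_) (enegForms-agree I≐W ls ls-over)
  ... | yes ℓ∈I | no ℓ∉W = ⊥-elim (ℓ∉W (to (I≐W ℓ ℓ∈𝒜) ℓ∈I))
  ... | no ℓ∉I  | yes ℓ∈W = ⊥-elim (ℓ∉I (from (I≐W ℓ ℓ∈𝒜) ℓ∈W))

  reduceRules-agree : ∀ {𝒜 I W} R → I ≐ W over 𝒜 → WellFormed (elp 𝒜 R) →
    map (reduceRule _≟_ I) R ≡ map (reduceRule _≟_ W) R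
  reduceRules-agree [] I≐W [] = refl
  reduceRules-agree (r ∷ R) I≐W ((_ , _ , epos-over , eneg-over) ∷ wf) =
    cong₂ _∷_ (cong (lrule (ehead r) (posAtoms (ebody r)))
                 (cong₂ (λ xs ys → negForms (ebody r) ++ xs ++ ys)
                   (eposForms-agree I≐W (epos r) epos-over)
                   (enegForms-agree I≐W (eneg r) eneg-over)))
              (reduceRules-agree R I≐W wf)

  reductHeadsWithin : ∀ {I} Π → WellFormed Π → HeadsWithin (atoms Π) (map (reduceRule _≟_ I) (rules Π))
  reductHeadsWithin Π wf = map⁺ (All.map proj₁ wf)

  answerSets-agree : ∀ Π {𝒜′ I W M} → WellFormed Π → atoms Π ⊆ 𝒜′ → I ≐ W over atoms Π →
    AnswerSet (EReduct _≟_ (elp 𝒜′ (rules Π)) I) M ⇔ AnswerSet (EReduct _≟_ Π W) M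
  answerSets-agree Π {𝒜′} {I} {W} {M} wf 𝒜⊆𝒜′ I≐W =
    subst (λ R → AnswerSet (lp 𝒜′ (map (reduceRule _≟_ I) (rules Π))) M ⇔ AnswerSet (lp (atoms Π) R) M)
      (reduceRules-agree (rules Π) I≐W wf)
      (answerSet-resize (reductHeadsWithin Π wf) 𝒜⊆𝒜′)

  Compatible-extends : ∀ {𝒜 𝒜′ I W} {𝓘 : List Atom → Set} → 𝒜 ⊆ 𝒜′ → (∀ J → 𝓘 J → J ⊆ 𝒜) →
    Extends 𝒜 𝒜′ I W → Compatible 𝒜′ I 𝓘 ⇔ Compatible 𝒜 W 𝓘
  Compatible-extends {𝒜} {𝒜′} {I} {W} {𝓘} 𝒜⊆𝒜′ 𝓘⊆𝒜 ext = mk⇔ restrict-compat extend-compat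
    where
    restrict-compat : Compatible 𝒜′ I 𝓘 → Compatible 𝒜 W 𝓘
    restrict-compat (nonempty , posI , negI , undI) =
      nonempty , (λ a p → posI a (extends-⊇ ext p)) , (λ a n → negI a (extends-⊇ ext n)) ,
      λ a a∈𝒜 p∉W n∉W →
        undI a (𝒜⊆𝒜′ a∈𝒜) (p∉W ∘′ to (extends-agree ext (pos a) a∈𝒜))
                           (n∉W ∘′ to (extends-agree ext (neg a) a∈𝒜))

    extend-compat : Compatible 𝒜 W 𝓘 → Compatible 𝒜′ I 𝓘
    extend-compat (nonempty , posW , negW , undW) =
      nonempty , (λ a p → posW a (extends-pos ext p)) , negI , undI
      where
      negI : ∀ a → neg a ∈ I → ∀ J → 𝓘 J → a ∉ J
      negI a n J 𝓘J with to (ext (neg a)) n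
      ... | inj₁ n∈W = negW a n∈W J 𝓘J
      ... | inj₂ (_ , refl , _ , a∉𝒜) = a∉𝒜 ∘′ 𝓘⊆𝒜 J 𝓘J

      undI : ∀ a → a ∈ 𝒜′ → pos a ∉ I → neg a ∉ I →
        (∃[ J ] (𝓘 J × a ∈ J)) × (∃[ J ] (𝓘 J × a ∉ J))
      undI a a∈𝒜′ p∉I n∉I with a ∈? 𝒜
      ... | yes a∈𝒜 = undW a a∈𝒜 (p∉I ∘′ extends-⊇ ext) (n∉I ∘′ extends-⊇ ext)
      ... | no a∉𝒜 = ⊥-elim (n∉I (from (ext (neg a)) (inj₂ (a , refl , a∈𝒜′ , a∉𝒜))))

  ↾-over : ∀ 𝒜 I → LitsOver 𝒜 (I ↾ 𝒜)
  ↾-over 𝒜 I = All.tabulate (λ q → proj₂ (∈-filter⁻ (λ ℓ → atomOf ℓ ∈? 𝒜) {xs = I} q))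

  extends-↾ : ∀ {𝒜 𝒜′ I} {𝓘 : List Atom → Set} → (∀ J → 𝓘 J → J ⊆ 𝒜) →
    CWI 𝒜′ I → Compatible 𝒜′ I 𝓘 → Extends 𝒜 𝒜′ I (I ↾ 𝒜)
  extends-↾ {𝒜} {𝒜′} {I} {𝓘} 𝓘⊆𝒜 (I-over , _) compat@(_ , _ , _ , undI) ℓ = mk⇔ (split ℓ) (merge ℓ)
    where
    split : ∀ ℓ → ℓ ∈ I → ℓ ∈ I ↾ 𝒜 ⊎ NegOutside 𝒜 𝒜′ ℓ
    split ℓ ℓ∈I with atomOf ℓ ∈? 𝒜
    ... | yes ℓ∈𝒜 = inj₁ (∈-filter⁺ (λ ℓ → atomOf ℓ ∈? 𝒜) ℓ∈I ℓ∈𝒜)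
    split (pos a) p | no a∉𝒜 = ⊥-elim (a∉𝒜 (pos-within 𝓘⊆𝒜 compat p))
    split (neg a) n | no a∉𝒜 = inj₂ (a , refl , All.lookup I-over n , a∉𝒜)

    -- An atom outside 𝒜 is in no J ∈ 𝓘, so it is neither true in I nor undetermined.
    merge : ∀ ℓ → ℓ ∈ I ↾ 𝒜 ⊎ NegOutside 𝒜 𝒜′ ℓ → ℓ ∈ I
    merge ℓ (inj₁ q) = proj₁ (∈-filter⁻ (λ ℓ → atomOf ℓ ∈? 𝒜) {xs = I} q)
    merge _ (inj₂ (a , refl , a∈𝒜′ , a∉𝒜)) with neg a ∈L? I | pos a ∈L? I
    ... | yes n∈I | _ = n∈I
    ... | no _ | yes p∈I = ⊥-elim (a∉𝒜 (pos-within 𝓘⊆𝒜 compat p∈I))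
    ... | no n∉I | no p∉I =
      let (J , 𝓘J , a∈J) , _ = undI a a∈𝒜′ p∉I n∉I in ⊥-elim (a∉𝒜 (𝓘⊆𝒜 J 𝓘J a∈J))

  CWV-extends : ∀ Π {𝒜′ I W} → WellFormed Π → atoms Π ⊆ 𝒜′ →
    LitsOver (atoms Π) W → Extends (atoms Π) 𝒜′ I W →
    CWV _≟_ (elp 𝒜′ (rules Π)) I ⇔ CWV _≟_ Π W
  CWV-extends Π wf 𝒜⊆𝒜′ W-over ext =
    CWI-extends 𝒜⊆𝒜′ W-over ext ×-⇔
    (Compatible-extends 𝒜⊆𝒜′ (λ _ → proj₁) ext
       ⇔-∘ Compatible-cong (λ _ → answerSets-agree Π wf 𝒜⊆𝒜′ (extends-agree ext)))

proposition2 : {Atom : Set} (_≟_ : DecidableEquality Atom) (Π : ELP {Atom}) (𝒜′ : List Atom) →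
    WellFormed Π → atoms Π ⊆ 𝒜′ → (∃[ b ] (b ∈ 𝒜′ × b ∉ atoms Π)) →
    ∀ (I : List (Lit {Atom})) →
      CWV _≟_ (elp 𝒜′ (rules Π)) I
        ⇔ (∃[ W ] (CWV _≟_ Π W × (∀ ℓ → (ℓ ∈ I) ⇔ (ℓ ∈ W ⊎ (∃[ a ] (ℓ ≡ neg a × a ∈ 𝒜′ × a ∉ atoms Π))))))
proposition2 _≟_ Π 𝒜′ wf 𝒜⊆𝒜′ _ I = mk⇔ restrict extend
  where
  restrict : CWV _≟_ (elp 𝒜′ (rules Π)) I →
    ∃[ W ] (CWV _≟_ Π W × Extends (atoms Π) 𝒜′ I W)
  restrict cwv@(cwi , compat) =
    let ext = extends-↾ _≟_ (λ _ → answerSet⊆ _≟_ (reductHeadsWithin _≟_ Π wf)) cwi compat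
    in _↾_ _≟_ I (atoms Π) , to (CWV-extends _≟_ Π wf 𝒜⊆𝒜′ (↾-over _≟_ (atoms Π) I) ext) cwv , ext

  extend : ∃[ W ] (CWV _≟_ Π W × Extends (atoms Π) 𝒜′ I W) → CWV _≟_ (elp 𝒜′ (rules Π)) I
  extend (W , cwv@((W-over , _) , _) , ext) = from (CWV-extends _≟_ Π wf 𝒜⊆𝒜′ W-over ext) cwv
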